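{- $\textsc{\#MonotoneSat}\in\#\mathsf{\Pi_2\text{ - }1VAR}$.
   Context: $\textsc{\#MonotoneSat}$: given a propositional CNF formula in which all literals are positive, output its number of satisfying assignments. Such a formula is encoded as an ordered structure over the vocabulary $\{C\}$, $C$ binary, with $C(c,x)$ iff variable $x$ appears in clause $c$. A counting problem $\#B$ on finite ordered $\sigma$-structures belongs to $\#\mathsf{\Pi_2\text{ - }1VAR}$ if there is a formula $\psi(\vec y,\vec z,X)=\phi(\vec y,\vec z)\wedge X(\vec z)$, with $\phi$ a first-order formula over $\sigma$ and $X$ a single second-order variable (occurring positively), such that for every input structure $\mathcal{A}$, $\#B(\mathcal{A})=|\{\langle X\rangle : \mathcal{A}\models\forall\vec y\exists\vec z\,\psi(\vec y,\vec z,X)\}|$. -}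

module Defs where

open import Data.Nat using (ℕ; zero; suc; _+_)
open import Data.Bool using (Bool; true; false; _∧_; _∨_; not; if_then_else_; T)
open import Data.Fin using (Fin; zero; suc; _≤?_)
open import Data.Fin.Properties using (_≟_)
open import Data.List using (List)
open import Data.Bool.ListAction using (all; any)
open import Data.List using () renaming (allFin to allFinL)
open import Data.Vec using (Vec; lookup)
open import Data.Vec.Functional using (Vector; _∷_; _++_)
open import Data.Product using (Σ)
open import Relation.Nullary.Decidable using (⌊_⌋)
open import Function using (_∘_)

∀ᵇ : ∀ {n} → (Fin n → Bool) → Bool
∀ᵇ {n} P = all P (allFinL n)

∃ᵇ : ∀ {n} → (Fin n → Bool) → Bool
∃ᵇ {n} P = any P (allFinL n)

∀ᵗ : ∀ {n} k → ((Fin k → Fin n) → Bool) → Bool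
∀ᵗ zero    P = P (λ ())
∀ᵗ (suc k) P = ∀ᵇ λ a → ∀ᵗ k (λ t → P (a ∷ t))

∃ᵗ : ∀ {n} k → ((Fin k → Fin n) → Bool) → Bool
∃ᵗ zero    P = P (λ ())
∃ᵗ (suc k) P = ∃ᵇ λ a → ∃ᵗ k (λ t → P (a ∷ t))

-- Finite ordered structures over the vocabulary {C}, C binary.
-- The universe is Fin n; the (built-in) linear order is the order of Fin n.

record Structure (n : ℕ) : Set where
  field
    C : Fin n → Fin n → Bool

-- An assignment is the set S of variables set to true
-- (represented as a subset of the universe contained in the variables);
-- it is satisfying iff every clause contains some variable of S.

isClause : ∀ {n} → Structure n → Fin n → Bool
isClause A c = ∃ᵇ λ x → Structure.C A c x

isVar : ∀ {n} → Structure n → Fin n → Bool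
isVar A x = ∃ᵇ λ c → Structure.C A c x

Assignment : ℕ → Set
Assignment n = Vec Bool n

isSatAssignment : ∀ {n} → Structure n → Assignment n → Bool
isSatAssignment A S =
  (∀ᵇ λ x → not (lookup S x) ∨ isVar A x)
  ∧ (∀ᵇ λ c → not (isClause A c) ∨ (∃ᵇ λ x → Structure.C A c x ∧ lookup S x))

-- the set of satisfying assignments; #MonotoneSat(A) is its cardinality
SatAssignments : ∀ {n} → Structure n → Set
SatAssignments {n} A = Σ (Assignment n) (λ S → T (isSatAssignment A S))

-- First-order logic over the vocabulary {C} of ordered structures
-- (atoms C(x,y), x ≤ y, x = y), with v free variables (de Bruijn style).

data Formula (v : ℕ) : Set where
  Cᶠ   : Fin v → Fin v → Formula v
  _≤ᶠ_ : Fin v → Fin v → Formula v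
  _≡ᶠ_ : Fin v → Fin v → Formula v
  ¬ᶠ_  : Formula v → Formula v
  _∧ᶠ_ : Formula v → Formula v → Formula v
  _∨ᶠ_ : Formula v → Formula v → Formula v
  ∀ᶠ   : Formula (suc v) → Formula v
  ∃ᶠ   : Formula (suc v) → Formula v

⟦_⟧ : ∀ {n v} → Formula v → Structure n → (Fin v → Fin n) → Bool
⟦ Cᶠ i j ⟧   A ρ = Structure.C A (ρ i) (ρ j)
⟦ i ≤ᶠ j ⟧   A ρ = ⌊ ρ i ≤? ρ j ⌋
⟦ i ≡ᶠ j ⟧   A ρ = ⌊ ρ i ≟ ρ j ⌋
⟦ ¬ᶠ φ ⟧     A ρ = not (⟦ φ ⟧ A ρ)
⟦ φ ∧ᶠ ψ ⟧   A ρ = ⟦ φ ⟧ A ρ ∧ ⟦ ψ ⟧ A ρ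
⟦ φ ∨ᶠ ψ ⟧   A ρ = ⟦ φ ⟧ A ρ ∨ ⟦ ψ ⟧ A ρ
⟦ ∀ᶠ φ ⟧     A ρ = ∀ᵇ λ a → ⟦ φ ⟧ A (a ∷ ρ)
⟦ ∃ᶠ φ ⟧     A ρ = ∃ᵇ λ a → ⟦ φ ⟧ A (a ∷ ρ)

-- Interpretations of an m-ary second-order variable X over Fin n:
-- a finite table of truth values indexed by m-tuples (first-order data,
-- so distinct relations are distinct elements of the type).

Table : ℕ → ℕ → Set
Table n zero    = Bool
Table n (suc m) = Vec (Table n m) n

_∋ᵗ_ : ∀ {n m} → Table n m → (Fin m → Fin n) → Bool
_∋ᵗ_ {m = zero}  b z = b
_∋ᵗ_ {m = suc m} t z = lookup t (z zero) ∋ᵗ (z ∘ suc)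

-- A ⊨ ∀ȳ ∃z̄ (φ(ȳ,z̄) ∧ X(z̄)), with |ȳ| = k, |z̄| = m;
-- in φ the variables 0..k-1 are ȳ and k..k+m-1 are z̄.
models-Π₂1VAR : ∀ {n} k m → Formula (k + m) → Structure n → Table n m → Bool
models-Π₂1VAR k m φ A X =
  ∀ᵗ k λ y → ∃ᵗ m λ z → ⟦ φ ⟧ A (y ++ z) ∧ (X ∋ᵗ z)

Witnesses : ∀ {n} k m → Formula (k + m) → Structure n → Set
Witnesses {n} k m φ A = Σ (Table n m) (λ X → T (models-Π₂1VAR k m φ A X))

-- A counting problem on {C}-structures, given by a set of "solutions" per
-- structure, is in #Π₂-1VAR iff for some φ its number of solutions equals
-- the number of X with A ⊨ ∀ȳ∃z̄ (φ ∧ X(z̄)) on every (nonempty) structure;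
-- "equal number" is expressed as a bijection between the two finite sets.

module Submission where

-- Take the sentence ∀y₁ ∀y₂ ∃z (φ(y₁,y₂,z) ∧ X(z)) with the quantifier-free
-- (up to the defined notions "variable" and "clause") formula
--     φ = (¬Var(y₁) ∧ y₁ = z)  ∨  (Var(y₁) ∧ (Clause(y₂) → C(y₂,z))).
-- A relation X satisfies it exactly when X contains every non-variable
-- and X meets every clause (the case where y₂ is no clause only asks for
-- X ≠ ∅, which follows because every variable lies in a clause).
-- A satisfying assignment S is a set of variables meeting every clause.
-- Hence S ↦ S ∪ {non-variables} and X ↦ X ∩ {variables} are mutually
-- inverse between satisfying assignments and witnesses X.

open import Defs
open import Data.Nat using (ℕ; _≤_; _+_)
open import Data.Bool using (Bool; true; false; _∧_; _∨_; not; T)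
open import Data.Bool.Properties using (T-∧; T-∨; T?; T-irrelevant)
open import Data.Empty using (⊥-elim)
open import Data.Fin using (Fin; zero; suc)
open import Data.Fin.Properties using (_≟_)
open import Data.List using () renaming (allFin to allFinL)
open import Data.List.Membership.Propositional using (lose)
open import Data.List.Membership.Propositional.Properties using (∈-allFin)
open import Data.List.Relation.Unary.All as All using ()
open import Data.List.Relation.Unary.All.Properties using (all⁺; all⁻)
open import Data.List.Relation.Unary.Any as Any using ()
open import Data.List.Relation.Unary.Any.Properties using (any⁺; any⁻)
open import Data.Product using (Σ; ∃; ∃-syntax; _×_; _,_; proj₁; proj₂)
open import Data.Product.Function.NonDependent.Propositional using (_×-⇔_)
open import Data.Sum using (_⊎_; inj₁; inj₂)
open import Data.Sum.Function.Propositional using (_⊎-⇔_)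
open import Data.Unit using (tt)
open import Data.Vec using (Vec; lookup; tabulate)
open import Data.Vec.Functional using ([]; _∷_; _++_)
open import Data.Vec.Properties using (lookup∘tabulate; tabulate∘lookup; tabulate-cong)
open import Function.Bundles using (_↔_; mk↔ₛ′; _⇔_; mk⇔; Equivalence)
open import Function.Construct.Composition using (_⇔-∘_)
open import Function.Construct.Identity using (⇔-id)
open import Relation.Nullary using (¬_; yes; no)
open import Relation.Nullary.Decidable using (⌊_⌋; toWitness; fromWitness)
open import Relation.Binary.PropositionalEquality using (_≡_; refl; cong; trans)

open Equivalence using (to; from)

T-not : ∀ {b} → T (not b) ⇔ (¬ T b)
T-not {true}  = mk⇔ (λ ()) (λ ¬t → ¬t tt)
T-not {false} = mk⇔ (λ _ ()) (λ _ → tt)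

T-⇒ : ∀ {b c} → T (not b ∨ c) ⇔ (T b → T c)
T-⇒ {true}  = mk⇔ (λ t _ → t) (λ f → f tt)
T-⇒ {false} = mk⇔ (λ _ ()) (λ _ → tt)

T-≟ : ∀ {n} {a b : Fin n} → T ⌊ a ≟ b ⌋ ⇔ (a ≡ b)
T-≟ = mk⇔ toWitness fromWitness

T-∀ᵇ : ∀ {n} {P : Fin n → Bool} → T (∀ᵇ P) ⇔ (∀ a → T (P a))
T-∀ᵇ {n} {P} = mk⇔
  (λ h a → All.lookup (all⁺ P (allFinL n) h) (∈-allFin a))
  (λ f → all⁻ P {xs = allFinL n} (All.tabulate (λ {a} _ → f a)))

T-∃ᵇ : ∀ {n} {P : Fin n → Bool} → T (∃ᵇ P) ⇔ (∃ λ a → T (P a))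
T-∃ᵇ {n} {P} = mk⇔
  (λ h → Any.satisfied (any⁻ P (allFinL n) h))
  (λ (a , p) → any⁺ P (lose {P = λ x → T (P x)} (∈-allFin a) p))

subtype-≡ : ∀ {B : Set} {P : B → Bool} {a b : B} {p : T (P a)} {q : T (P b)} →
            a ≡ b → _≡_ {A = Σ B λ x → T (P x)} (a , p) (b , q)
subtype-≡ {a = a} {p = p} {q} refl = cong (a ,_) (T-irrelevant p q)

∨-not-∧ : ∀ s v → (T s → T v) → (s ∨ not v) ∧ v ≡ s
∨-not-∧ true  true  _ = refl
∨-not-∧ true  false f = ⊥-elim (f tt)
∨-not-∧ false true  _ = refl
∨-not-∧ false false _ = refl

∧-∨-not : ∀ x v → (¬ T v → T x) → (x ∧ v) ∨ not v ≡ x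
∧-∨-not true  true  _ = refl
∧-∨-not true  false _ = refl
∧-∨-not false true  _ = refl
∧-∨-not false false f = ⊥-elim (f (λ ()))

tabulate-lookup : ∀ {A : Set} {n} {f : Fin n → A} (xs : Vec A n) →
                  (∀ i → f i ≡ lookup xs i) → tabulate f ≡ xs
tabulate-lookup xs f≗xs = trans (tabulate-cong f≗xs) (tabulate∘lookup xs)

module Complement {n : ℕ} (V : Fin n → Bool) where

  close : Vec Bool n → Vec Bool n
  close S = tabulate λ x → lookup S x ∨ not (V x)

  restrict : Vec Bool n → Vec Bool n
  restrict X = tabulate λ x → lookup X x ∧ V x

  restrict-close : ∀ S → (∀ x → T (lookup S x) → T (V x)) → restrict (close S) ≡ S
  restrict-close S S⊆V = tabulate-lookup S λ x →
    trans (cong (_∧ V x) (lookup∘tabulate _ x)) (∨-not-∧ (lookup S x) (V x) (S⊆V x))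

  close-restrict : ∀ X → (∀ x → ¬ T (V x) → T (lookup X x)) → close (restrict X) ≡ X
  close-restrict X ∁V⊆X = tabulate-lookup X λ x →
    trans (cong (_∨ not (V x)) (lookup∘tabulate _ x)) (∧-∨-not (lookup X x) (V x) (∁V⊆X x))

  T-close : ∀ S x → T (lookup (close S) x) ⇔ (T (lookup S x) ⊎ ¬ T (V x))
  T-close S x rewrite lookup∘tabulate (λ y → lookup S y ∨ not (V y)) x =
    (⇔-id _ ⊎-⇔ T-not) ⇔-∘ T-∨

  T-restrict : ∀ X x → T (lookup (restrict X) x) ⇔ (T (lookup X x) × T (V x))
  T-restrict X x rewrite lookup∘tabulate (λ y → lookup X y ∧ V y) x = T-∧

isVarᶠ : ∀ {v} → Fin v → Formula v
isVarᶠ x = ∃ᶠ (Cᶠ zero (suc x))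

isClauseᶠ : ∀ {v} → Fin v → Formula v
isClauseᶠ c = ∃ᶠ (Cᶠ (suc c) zero)

y₁ y₂ z : Fin (2 + 1)
y₁ = zero
y₂ = suc zero
z  = suc (suc zero)

φ : Formula (2 + 1)
φ = ((¬ᶠ isVarᶠ y₁) ∧ᶠ (y₁ ≡ᶠ z)) ∨ᶠ (isVarᶠ y₁ ∧ᶠ ((¬ᶠ isClauseᶠ y₂) ∨ᶠ Cᶠ y₂ z))

module _ {n : ℕ} (A : Structure n) where
  open Structure A using (C)
  open Complement (isVar A)

  Covers : (Fin n → Bool) → Set
  Covers P = ∀ c → T (isClause A c) → ∃ λ x → T (C c x) × T (P x)

  var-of : ∀ {c x} → T (C c x) → T (isVar A x)
  var-of {c} cx = from T-∃ᵇ (c , cx)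

  clause-of : ∀ {c x} → T (C c x) → T (isClause A c)
  clause-of {x = x} cx = from T-∃ᵇ (x , cx)

  sat⇔ : ∀ S → T (isSatAssignment A S) ⇔
         ((∀ x → T (lookup S x) → T (isVar A x)) × Covers (lookup S))
  sat⇔ S = mk⇔ sound complete
    where
    sound : T (isSatAssignment A S) →
            (∀ x → T (lookup S x) → T (isVar A x)) × Covers (lookup S)
    sound h with to (T-∧ {∀ᵇ {n} _}) h
    ... | vars , covers =
      (λ x → to T-⇒ (to T-∀ᵇ vars x)) ,
      (λ c cl → let (x , p) = to T-∃ᵇ (to T-⇒ (to T-∀ᵇ covers c) cl) in x , to T-∧ p)

    complete : (∀ x → T (lookup S x) → T (isVar A x)) × Covers (lookup S) →
               T (isSatAssignment A S)
    complete (vars , covers) = from (T-∧ {∀ᵇ {n} _})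
      ( from T-∀ᵇ (λ x → from T-⇒ (vars x))
      , from T-∀ᵇ (λ c → from T-⇒ (λ cl →
          let (x , cx , Sx) = covers c cl in from T-∃ᵇ (x , from T-∧ (cx , Sx)))))

  Admissible : Fin n → Fin n → Fin n → Set
  Admissible a b c =  (¬ T (isVar A a) × a ≡ c)
                   ⊎ (T (isVar A a) × (T (isClause A b) → T (C b c)))

  φ-meaning : ∀ ρ → T (⟦ φ ⟧ A ρ) ⇔ Admissible (ρ y₁) (ρ y₂) (ρ z)
  φ-meaning ρ = (((T-not ×-⇔ T-≟) ⇔-∘ T-∧) ⊎-⇔ ((⇔-id _ ×-⇔ T-⇒) ⇔-∘ T-∧)) ⇔-∘ T-∨

  env : Fin n → Fin n → Fin n → Fin (2 + 1) → Fin n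
  env a b c = (a ∷ b ∷ []) ++ (c ∷ [])

  models⇔admissible : ∀ (X : Table n 1) → T (models-Π₂1VAR 2 1 φ A X) ⇔
                      (∀ a b → ∃ λ c → Admissible a b c × T (lookup X c))
  models⇔admissible X = mk⇔
    (λ h a b → let (c , p) = to T-∃ᵇ (to T-∀ᵇ (to T-∀ᵇ h a) b)
                   (φabc , Xc) = to T-∧ p
               in c , to (φ-meaning (env a b c)) φabc , Xc)
    (λ f → from T-∀ᵇ λ a → from T-∀ᵇ λ b →
       let (c , adm , Xc) = f a b in from T-∃ᵇ (c , from T-∧ (from (φ-meaning (env a b c)) adm , Xc)))

  -- Set-theoretic reading of φ: admissible choices in P exist for all
  -- a, b iff P contains every non-variable and covers every clause.
  -- (For a variable a and a non-clause b any element of P is admissible;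
  -- one exists because a lies in a clause, which P covers.)
  admissible⇔ : ∀ (P : Fin n → Bool) →
                (∀ a b → ∃ λ c → Admissible a b c × T (P c)) ⇔
                ((∀ x → ¬ T (isVar A x) → T (P x)) × Covers P)
  admissible⇔ P = mk⇔ sound complete
    where
    sound : (∀ a b → ∃ λ c → Admissible a b c × T (P c)) →
            (∀ x → ¬ T (isVar A x) → T (P x)) × Covers P
    sound f = nonvars , covers
      where
      nonvars : ∀ x → ¬ T (isVar A x) → T (P x)
      nonvars x ¬var with f x x
      ... | c , inj₁ (_ , refl) , Pc = Pc
      ... | c , inj₂ (var , _)  , Pc = ⊥-elim (¬var var)

      -- Probe with y₁ a variable of the clause and y₂ the clause itself.
      covers : Covers P
      covers c cl with to T-∃ᵇ cl
      ... | x , cx with f x c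
      ...   | d , inj₁ (¬var , _)   , Pd = ⊥-elim (¬var (var-of cx))
      ...   | d , inj₂ (_ , cl⇒cd) , Pd = d , cl⇒cd cl , Pd

    complete : (∀ x → ¬ T (isVar A x) → T (P x)) × Covers P →
               ∀ a b → ∃ λ c → Admissible a b c × T (P c)
    complete (nonvars , covers) a b with T? (isVar A a) | T? (isClause A b)
    ... | no ¬var | _ = a , inj₁ (¬var , refl) , nonvars a ¬var
    ... | yes var | yes cl = let (c , bc , Pc) = covers b cl in c , inj₂ (var , λ _ → bc) , Pc
    ... | yes var | no ¬cl =
      let (d , da) = to T-∃ᵇ var
          (c , _ , Pc) = covers d (clause-of da)
      in c , inj₂ (var , λ cl → ⊥-elim (¬cl cl)) , Pc

  witness⇔ : ∀ (X : Table n 1) → T (models-Π₂1VAR 2 1 φ A X) ⇔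
             ((∀ x → ¬ T (isVar A x) → T (lookup X x)) × Covers (lookup X))
  witness⇔ X = admissible⇔ (lookup X) ⇔-∘ models⇔admissible X

  covers-close : ∀ S → Covers (lookup S) → Covers (lookup (close S))
  covers-close S covers c cl =
    let (x , cx , Sx) = covers c cl in x , cx , from (T-close S x) (inj₁ Sx)

  covers-restrict : ∀ X → Covers (lookup X) → Covers (lookup (restrict X))
  covers-restrict X covers c cl =
    let (x , cx , Xx) = covers c cl in x , cx , from (T-restrict X x) (Xx , var-of cx)

  sat→witness : SatAssignments A → Witnesses 2 1 φ A
  sat→witness (S , sat) = close S , from (witness⇔ (close S))
    ((λ x ¬var → from (T-close S x) (inj₂ ¬var)) , covers-close S (proj₂ (to (sat⇔ S) sat)))

  witness→sat : Witnesses 2 1 φ A → SatAssignments A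
  witness→sat (X , wit) = restrict X , from (sat⇔ (restrict X))
    ((λ x Rx → proj₂ (to (T-restrict X x) Rx)) , covers-restrict X (proj₂ (to (witness⇔ X) wit)))

  sat↔witness : SatAssignments A ↔ Witnesses 2 1 φ A
  sat↔witness = mk↔ₛ′ sat→witness witness→sat
    (λ (X , wit) → subtype-≡ (close-restrict X (proj₁ (to (witness⇔ X) wit))))
    (λ (S , sat) → subtype-≡ (restrict-close S (proj₁ (to (sat⇔ S) sat))))

-- #MonotoneSat ∈ #Π₂-1VAR, witnessed by ∀y₁ ∀y₂ ∃z (φ(y₁,y₂,z) ∧ X(z));
-- the bijection exists on every structure, nonempty or not.
theorem4 : ∃[ k ] ∃[ m ] Σ (Formula (k + m)) λ φ →
             (n : ℕ) → 1 ≤ n → (A : Structure n) →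
               SatAssignments A ↔ Witnesses k m φ A
theorem4 = 2 , 1 , φ , λ n _ A → sat↔witness A
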